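{- The theory $\mathbf{KK}$ is not closed generic.
   Context: Fix a nonempty set of symbols called propositional atoms and a symbol $\mathrm{K}$ which is not a propositional atom. Formulas are defined recursively: every propositional atom is a formula; if $\varphi,\psi$ are formulas then so are $\neg\varphi$, $(\varphi\wedge\psi)$, $(\varphi\vee\psi)$, $(\varphi\rightarrow\psi)$; if $\varphi$ is a formula then so is $\mathrm{K}(\varphi)$. A formula is basic if it is a propositional atom or of the form $\mathrm{K}\varphi$. A theory is a set of formulas. A model is a function assigning a truth value to every basic formula; truth $\mathscr M\models\varphi$ of an arbitrary formula is defined from the values of basic formulas by the classical truth tables (formulas $\mathrm{K}\varphi$ are treated like atoms). $\mathscr M\models T$ means $\mathscr M\models\varphi$ for all $\varphi\in T$; $T\models\varphi$ means every model of $T$ satisfies $\varphi$. A theory $T$ is closed if $\varphi\in T$ implies $\mathrm{K}\varphi\in T$. $\mathbf{KK}$ is the set of all formulas $\mathrm{K}\varphi\rightarrow\mathrm{K}\mathrm{K}\varphi$. For a theory $T$ and a set $S$ of propositional atoms, $\mathscr M_{T,S}$ is the model with $\mathscr M_{T,S}\models p$ iff $p\in S$ for atoms $p$, and $\mathscr M_{T,S}\models\mathrm{K}\varphi$ iff $T\models\varphi$. A theory $T$ is closed generic if for every set $S$ of propositional atoms and every closed theory $T'\supseteq T$, $\mathscr M_{T',S}\models T$. -}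

module Defs where

open import Data.Bool using (Bool; true; false; not; _∧_; _∨_)
open import Data.Empty using (⊥)
open import Data.Product using (Σ; _×_)
open import Relation.Binary.PropositionalEquality using (_≡_)
open import Relation.Nullary using (¬_)

module _ (Atom : Set) where

  data Formula : Set where
    atom : Atom → Formula
    ¬'_  : Formula → Formula
    _∧'_ : Formula → Formula → Formula
    _∨'_ : Formula → Formula → Formula
    _⇒'_ : Formula → Formula → Formula
    K    : Formula → Formula

  data Basic : Set where
    bAtom : Atom → Basic
    bK    : Formula → Basic

  Model : Set
  Model = Basic → Bool

  eval : Model → Formula → Bool
  eval M (atom p)  = M (bAtom p)
  eval M (¬' φ)    = not (eval M φ)
  eval M (φ ∧' ψ)  = eval M φ ∧ eval M ψ
  eval M (φ ∨' ψ)  = eval M φ ∨ eval M ψ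
  eval M (φ ⇒' ψ)  = not (eval M φ) ∨ eval M ψ
  eval M (K φ)     = M (bK φ)

  _⊨_ : Model → Formula → Set
  M ⊨ φ = eval M φ ≡ true

  Theory : Set₁
  Theory = Formula → Set

  _⊨T_ : Model → Theory → Set
  M ⊨T T = ∀ φ → T φ → M ⊨ φ

  _⊩_ : Theory → Formula → Set
  T ⊩ φ = ∀ (M : Model) → M ⊨T T → M ⊨ φ

  _⊆_ : Theory → Theory → Set
  T ⊆ T' = ∀ φ → T φ → T' φ

  Closed : Theory → Set
  Closed T = ∀ φ → T φ → T (K φ)

  KK : Theory
  KK χ = Σ Formula (λ φ → χ ≡ (K φ ⇒' K (K φ)))

  -- Truth in the model M_{T,S}: atoms p are true iff p ∈ S, and
  -- K φ is true iff T ⊩ φ.  Since "T ⊩ φ" is a proposition that is not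
  -- decidable constructively, this model is given by its truth relation,
  -- with the classical truth tables rendered by their stable (negative)
  -- forms; classically this is exactly the truth-table definition.
  Sat : Theory → (Atom → Set) → Formula → Set
  Sat T S (atom p) = S p
  Sat T S (¬' φ)   = ¬ Sat T S φ
  Sat T S (φ ∧' ψ) = Sat T S φ × Sat T S ψ
  Sat T S (φ ∨' ψ) = ¬ (¬ Sat T S φ × ¬ Sat T S ψ)
  Sat T S (φ ⇒' ψ) = Sat T S φ → Sat T S ψ
  Sat T S (K φ)    = T ⊩ φ

  SatT : Theory → (Atom → Set) → Theory → Set
  SatT T S T₀ = ∀ φ → T₀ φ → Sat T S φ

  ClosedGeneric : Theory → Set₁
  ClosedGeneric T = ∀ (S : Atom → Set) (T' : Theory) →
    Closed T' → T ⊆ T' → SatT T' S T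

{-# OPTIONS --safe #-}

-- Let T' be the closure under K of KK ∪ {p}. Then T' ⊩ p ∧ p, but T' ⊮ K (p ∧ p):
-- the model making every atom true and K ψ true exactly when ψ is not a
-- conjunction satisfies T', since T' contains no conjunctions. Hence the
-- instance K (p ∧ p) → K K (p ∧ p) of KK fails in M_{T',S}.
module Submission where

open import Data.Bool using (Bool; true; false; not; _∧_)
open import Data.Bool.Properties using (∨-zeroʳ)
open import Data.Product using (_,_)
open import Data.Sum using (_⊎_; inj₁; inj₂)
open import Data.Unit using (⊤)
open import Relation.Binary.PropositionalEquality using (_≡_; refl; cong; cong₂)
open import Relation.Nullary using (¬_)

open import Defs

module _ {Atom : Set} where

  data KClosure (T : Theory Atom) : Theory Atom where
    base : ∀ {φ} → T φ → KClosure T φ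
    step : ∀ {φ} → KClosure T φ → KClosure T (K φ)

  KClosure-closed : (T : Theory Atom) → Closed Atom (KClosure T)
  KClosure-closed T _ = step

  ∈⇒⊩ : {T : Theory Atom} {φ : Formula Atom} → T φ → _⊩_ Atom T φ
  ∈⇒⊩ {φ = φ} φ∈T M M⊨T = M⊨T φ φ∈T

  ⊩-∧ : {T : Theory Atom} {φ ψ : Formula Atom} →
        _⊩_ Atom T φ → _⊩_ Atom T ψ → _⊩_ Atom T (φ ∧' ψ)
  ⊩-∧ T⊩φ T⊩ψ M M⊨T = cong₂ _∧_ (T⊩φ M M⊨T) (T⊩ψ M M⊨T)

  isConj : Formula Atom → Bool
  isConj (_ ∧' _) = true
  isConj _        = false

  ConjFree : Theory Atom → Set
  ConjFree T = ∀ {φ} → T φ → isConj φ ≡ false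

  KClosure-conjFree : {T : Theory Atom} → ConjFree T → ConjFree (KClosure T)
  KClosure-conjFree free (base φ∈T) = free φ∈T
  KClosure-conjFree free (step _)   = refl

  conjBlind : Model Atom
  conjBlind (bAtom _) = true
  conjBlind (bK ψ)    = not (isConj ψ)

  conjBlind-⊨K : {ψ : Formula Atom} → isConj ψ ≡ false → _⊨_ Atom conjBlind (K ψ)
  conjBlind-⊨K ψ-nonconj = cong not ψ-nonconj

  conjBlind-⊨KClosure : {T : Theory Atom} → ConjFree T → _⊨T_ Atom conjBlind T →
                        _⊨T_ Atom conjBlind (KClosure T)
  conjBlind-⊨KClosure free ⊨T _ (base φ∈T) = ⊨T _ φ∈T
  conjBlind-⊨KClosure free ⊨T _ (step φ∈T) =
    conjBlind-⊨K (KClosure-conjFree free φ∈T)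

  conjBlind-⊮K∧ : (T : Theory Atom) (φ ψ : Formula Atom) →
                  _⊨T_ Atom conjBlind T → ¬ _⊩_ Atom T (K (φ ∧' ψ))
  conjBlind-⊮K∧ T φ ψ ⊨T T⊩ with T⊩ conjBlind ⊨T
  ... | ()

  KK+ : Atom → Theory Atom
  KK+ p χ = KK Atom χ ⊎ χ ≡ atom p

  KK+-conjFree : (p : Atom) → ConjFree (KK+ p)
  KK+-conjFree p (inj₁ (_ , refl)) = refl
  KK+-conjFree p (inj₂ refl)       = refl

  conjBlind-⊨KK+ : (p : Atom) → _⊨T_ Atom conjBlind (KK+ p)
  conjBlind-⊨KK+ p _ (inj₁ (φ , refl)) = ∨-zeroʳ (not (conjBlind (bK φ)))
  conjBlind-⊨KK+ p _ (inj₂ refl)       = refl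

corollary26 : (Atom : Set) → Atom → ¬ ClosedGeneric Atom (KK Atom)
corollary26 Atom p generic = ⊮K[p∧p] (KKinstance ⊩p∧p)
  where
    p∧p : Formula Atom
    p∧p = atom p ∧' atom p

    T' : Theory Atom
    T' = KClosure (KK+ p)

    KKinstance : Sat Atom T' (λ _ → ⊤) (K p∧p ⇒' K (K p∧p))
    KKinstance = generic (λ _ → ⊤) T' (KClosure-closed (KK+ p))
      (λ _ kk → base (inj₁ kk)) _ (p∧p , refl)

    ⊩p∧p : _⊩_ Atom T' p∧p
    ⊩p∧p = ⊩-∧ {φ = atom p} {ψ = atom p} p∈T' p∈T'
      where
        p∈T' : _⊩_ Atom T' (atom p)
        p∈T' = ∈⇒⊩ (base (inj₂ refl))

    ⊮K[p∧p] : ¬ _⊩_ Atom T' (K p∧p)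
    ⊮K[p∧p] = conjBlind-⊮K∧ T' (atom p) (atom p)
      (conjBlind-⊨KClosure (KK+-conjFree p) (conjBlind-⊨KK+ p))
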